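{- A colored graph $G$ admits a tree decomposition in which every bag contains at most one vertex of each color if and only if $G$ admits a tree decomposition in which every bag contains exactly one vertex of each color.
   Context: A colored graph assigns each vertex one color; "each color" ranges over the colors used by the vertices of $G$. A tree decomposition of $G=(V,E)$ is a tree $T$ together with a subset (bag) of $V$ for each node of $T$ such that every vertex lies in some bag, both endpoints of every edge lie together in some bag, and for each vertex $v$ the nodes whose bags contain $v$ induce a connected subtree of $T$. -}

module Defs where

open import Data.Nat using (ℕ; _≤_)
open import Data.Fin using (Fin)
open import Data.Fin.Subset using (Subset; _∈_)
open import Data.Bool using (Bool; true)
open import Data.List using (List; []; _∷_; _++_; length)
open import Data.List.Relation.Unary.Linked using (Linked)
open import Data.List.Relation.Unary.Unique.Propositional using (Unique)
open import Data.Product using (Σ; ∃; _×_)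
open import Relation.Binary.PropositionalEquality using (_≡_)
open import Relation.Nullary using (¬_)
open import Level using (0ℓ)

record Graph (n : ℕ) : Set where
  field
    adj    : Fin n → Fin n → Bool
    sym    : ∀ u v → adj u v ≡ true → adj v u ≡ true
    irrefl : ∀ v → ¬ (adj v v ≡ true)

  Adj : Fin n → Fin n → Set
  Adj u v = adj u v ≡ true

open Graph public using (Adj)

data WalkIn {n : ℕ} (G : Graph n) (P : Fin n → Set) : Fin n → Fin n → Set where
  here  : ∀ {u} → P u → WalkIn G P u u
  step  : ∀ {u w v} → P u → Adj G u w → WalkIn G P w v → WalkIn G P u v

InducesConnected : {n : ℕ} → Graph n → (Fin n → Set) → Set
InducesConnected G P = ∀ u v → P u → P v → WalkIn G P u v

Connected : {n : ℕ} → Graph n → Set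
Connected G = ∀ u v → WalkIn G (λ _ → Data.Unit.⊤) u v
  where import Data.Unit

HasCycle : {n : ℕ} → Graph n → Set
HasCycle G = Σ _ λ x → Σ (List _) λ ws →
  (2 ≤ length ws) × Unique (x ∷ ws) × Linked (Adj G) (x ∷ ws ++ x ∷ [])

record Tree (m : ℕ) : Set where
  field
    graph    : Graph m
    nonempty : Fin m
    connected : Connected graph
    acyclic  : ¬ HasCycle graph

record TreeDecomposition {n : ℕ} (G : Graph n) : Set where
  field
    m    : ℕ
    tree : Tree m
    bag  : Fin m → Subset n
    covers     : ∀ v → ∃ λ t → v ∈ bag t
    edgeCovers : ∀ u v → Adj G u v → ∃ λ t → u ∈ bag t × v ∈ bag t
    subtree    : ∀ v → InducesConnected (Tree.graph tree) (λ t → v ∈ bag t)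

AtMostOnePerColor : {n k : ℕ} {G : Graph n} → (Fin n → Fin k) → TreeDecomposition G → Set
AtMostOnePerColor c D = ∀ t u v → u ∈ bag t → v ∈ bag t → c u ≡ c v → u ≡ v
  where open TreeDecomposition D

-- Every bag contains exactly one vertex of each color used by G.
ExactlyOnePerColor : {n k : ℕ} {G : Graph n} → (Fin n → Fin k) → TreeDecomposition G → Set
ExactlyOnePerColor c D =
  AtMostOnePerColor c D × (∀ t w → ∃ λ u → u ∈ bag t × c u ≡ c w)
  where open TreeDecomposition D

{-# OPTIONS --safe #-}
module Submission where

-- Starting from a decomposition whose bags are colour-injective, repeatedly pick tree-adjacent
-- nodes s, t and a vertex v ∈ bag s whose colour is missing from bag t, and add v to bag t.
-- The nodes containing v stay connected because t is adjacent to s, and bag t stays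
-- colour-injective because v's colour was missing; as bags only grow, this terminates.
-- Afterwards the nodes whose bag has a given colour are closed under tree adjacency, so by
-- connectivity of the tree every bag has every colour.

open import Defs
open import Data.Nat using (ℕ; zero; suc; _+_; _∸_; _≤_; _<_; z≤n; s≤s⁻¹)
open import Data.Nat.Properties using (+-mono-≤; +-mono-≤-<; +-mono-<-≤; ∸-monoʳ-≤; ∸-monoʳ-<; <-≤-trans; n<1+n)
open import Data.Fin using (Fin; _≟_)
import Data.Fin as Fin
open import Data.Fin.Properties using (any?)
open import Data.Fin.Subset using (Subset; _∈_; _∉_; _∪_; ⁅_⁆; ∣_∣)
open import Data.Fin.Subset.Properties using (_∈?_; x∈p∪q⁺; x∈p∪q⁻; x∈⁅x⁆; x∈⁅y⁆⇒x≡y; p⊂q⇒∣p∣<∣q∣; p⊆q⇒∣p∣≤∣q∣; ∣p∣≤n)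
open import Data.Bool using (true)
import Data.Bool as Bool
open import Data.Empty using (⊥-elim)
open import Data.Product using (Σ; ∃; _×_; _,_; proj₁; proj₂)
open import Data.Sum using (_⊎_; inj₁; inj₂; map₂)
open import Data.Vec.Functional using (updateAt)
open import Data.Vec.Functional.Properties using (updateAt-updates; updateAt-minimal)
open import Function using (_∘_)
open import Function.Bundles using (_⇔_; mk⇔)
open import Relation.Binary.PropositionalEquality using (_≡_; refl; sym; trans; subst)
open import Relation.Nullary using (¬_; Dec; yes; no; _×-dec_; ¬?)
open import Relation.Nullary.Decidable using (decidable-stable)

module _ {n : ℕ} {G : Graph n} where

  walkMap : ∀ {P Q : Fin n → Set} → (∀ {x} → P x → Q x) →
            ∀ {a b} → WalkIn G P a b → WalkIn G Q a b
  walkMap f (here p)     = here (f p)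
  walkMap f (step p e w) = step (f p) e (walkMap f w)

  _++ʷ_ : ∀ {P : Fin n → Set} {a b d} → WalkIn G P a b → WalkIn G P b d → WalkIn G P a d
  here _     ++ʷ w′ = w′
  step p e w ++ʷ w′ = step p e (w ++ʷ w′)

  walk-transport : ∀ {P R : Fin n → Set} → (∀ {s t} → Adj G s t → R s → R t) →
                   ∀ {a b} → WalkIn G P a b → R a → R b
  walk-transport f (here _)     r = r
  walk-transport f (step _ e w) r = walk-transport f w (f e r)

  InducesConnected-resp : ∀ {P Q : Fin n → Set} →
    InducesConnected G P → (∀ {x} → P x → Q x) → (∀ {x} → Q x → P x) → InducesConnected G Q
  InducesConnected-resp conn P⊆Q Q⊆P a b Qa Qb = walkMap P⊆Q (conn a b (Q⊆P Qa) (Q⊆P Qb))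

  InducesConnected-extend : ∀ {P Q : Fin n → Set} {s t} →
    InducesConnected G P → (∀ {x} → P x → Q x) → P s → Adj G s t → Q t →
    (∀ {x} → Q x → P x ⊎ x ≡ t) → InducesConnected G Q
  InducesConnected-extend {P} {Q} {s} {t} conn P⊆Q Ps st Qt Q⊆P+t a b Qa Qb =
    toS a Qa ++ʷ fromS b Qb
    where
    toS : ∀ x → Q x → WalkIn G Q x s
    toS x Qx with Q⊆P+t Qx
    ... | inj₁ Px   = walkMap P⊆Q (conn x s Px Ps)
    ... | inj₂ refl = step Qt (Graph.sym G s t st) (here (P⊆Q Ps))
    fromS : ∀ x → Q x → WalkIn G Q s x
    fromS x Qx with Q⊆P+t Qx
    ... | inj₁ Px   = walkMap P⊆Q (conn s x Ps Px)
    ... | inj₂ refl = step (P⊆Q Ps) st (here Qt)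

∑ : ∀ {m} → (Fin m → ℕ) → ℕ
∑ {zero}  f = 0
∑ {suc m} f = f Fin.zero + ∑ (λ i → f (Fin.suc i))

∑-mono-≤ : ∀ {m} {f g : Fin m → ℕ} → (∀ i → f i ≤ g i) → ∑ f ≤ ∑ g
∑-mono-≤ {zero}  f≤g = z≤n
∑-mono-≤ {suc m} f≤g = +-mono-≤ (f≤g Fin.zero) (∑-mono-≤ (λ i → f≤g (Fin.suc i)))

∑-mono-< : ∀ {m} {f g : Fin m → ℕ} → (∀ i → f i ≤ g i) → ∀ j → f j < g j → ∑ f < ∑ g
∑-mono-< {suc m} f≤g Fin.zero    fj<gj = +-mono-<-≤ fj<gj (∑-mono-≤ (λ i → f≤g (Fin.suc i)))
∑-mono-< {suc m} f≤g (Fin.suc j) fj<gj = +-mono-≤-< (f≤g Fin.zero) (∑-mono-< (λ i → f≤g (Fin.suc i)) j fj<gj)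

module _ {m n : ℕ} where

  insertAt : (Fin m → Subset n) → Fin m → Fin n → Fin m → Subset n
  insertAt B t v = updateAt B t (_∪ ⁅ v ⁆)

  ∈-insertAt⁺ : ∀ B t v {t′ x} → x ∈ B t′ → x ∈ insertAt B t v t′
  ∈-insertAt⁺ B t v {t′} {x} x∈B with t′ ≟ t
  ... | yes refl = subst (x ∈_) (sym (updateAt-updates t B)) (x∈p∪q⁺ (inj₁ x∈B))
  ... | no t′≢t  = subst (x ∈_) (sym (updateAt-minimal t′ t B t′≢t)) x∈B

  ∈-insertAt-new : ∀ B t v → v ∈ insertAt B t v t
  ∈-insertAt-new B t v = subst (v ∈_) (sym (updateAt-updates t B)) (x∈p∪q⁺ (inj₂ (x∈⁅x⁆ v)))

  ∈-insertAt⁻ : ∀ B t v {t′ x} → x ∈ insertAt B t v t′ → x ∈ B t′ ⊎ (t′ ≡ t × x ≡ v)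
  ∈-insertAt⁻ B t v {t′} {x} x∈B′ with t′ ≟ t
  ... | no t′≢t  = inj₁ (subst (x ∈_) (updateAt-minimal t′ t B t′≢t) x∈B′)
  ... | yes refl with x∈p∪q⁻ (B t) ⁅ v ⁆ (subst (x ∈_) (updateAt-updates t B) x∈B′)
  ...   | inj₁ x∈B = inj₁ x∈B
  ...   | inj₂ x≡v = inj₂ (refl , x∈⁅y⁆⇒x≡y v x≡v)

  deficit : (Fin m → Subset n) → ℕ
  deficit B = ∑ (λ t → n ∸ ∣ B t ∣)

  deficit-insertAt : ∀ B t v → v ∉ B t → deficit (insertAt B t v) < deficit B
  deficit-insertAt B t v v∉B = ∑-mono-< shrinks t
    (∸-monoʳ-< (p⊂q⇒∣p∣<∣q∣ (∈-insertAt⁺ B t v , v , ∈-insertAt-new B t v , v∉B)) (∣p∣≤n (insertAt B t v t)))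
    where
    shrinks : ∀ t′ → n ∸ ∣ insertAt B t v t′ ∣ ≤ n ∸ ∣ B t′ ∣
    shrinks t′ = ∸-monoʳ-≤ n (p⊆q⇒∣p∣≤∣q∣ (∈-insertAt⁺ B t v))

module _ {n : ℕ} {G : Graph n} (D : TreeDecomposition G) where
  open TreeDecomposition D

  TreeAdj : Fin m → Fin m → Set
  TreeAdj = Adj (Tree.graph tree)

  addToBag : ∀ {s t v} → TreeAdj s t → v ∈ bag s → TreeDecomposition G
  addToBag {s} {t} {v} st v∈s = record
    { m          = m
    ; tree       = tree
    ; bag        = insertAt bag t v
    ; covers     = λ x → let (t₀ , x∈t₀) = covers x in t₀ , grow x∈t₀
    ; edgeCovers = λ x y xy → let (t₀ , x∈t₀ , y∈t₀) = edgeCovers x y xy in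
                     t₀ , grow x∈t₀ , grow y∈t₀
    ; subtree    = subtree′
    }
    where
    grow : ∀ {t′ x} → x ∈ bag t′ → x ∈ insertAt bag t v t′
    grow = ∈-insertAt⁺ bag t v
    subtree′ : ∀ x → InducesConnected (Tree.graph tree) (λ t′ → x ∈ insertAt bag t v t′)
    subtree′ x with x ≟ v
    ... | yes refl = InducesConnected-extend (subtree v) grow v∈s st (∈-insertAt-new bag t v)
                       (map₂ proj₁ ∘ ∈-insertAt⁻ bag t v)
    ... | no x≢v   = InducesConnected-resp (subtree x) grow old
      where
      old : ∀ {t′} → x ∈ insertAt bag t v t′ → x ∈ bag t′
      old x∈t′ with ∈-insertAt⁻ bag t v x∈t′
      ... | inj₁ x∈t′ = x∈t′
      ... | inj₂ (_ , x≡v) = ⊥-elim (x≢v x≡v)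

module _ {n k : ℕ} {G : Graph n} (c : Fin n → Fin k) where

  HasColourIn : Subset n → Fin n → Set
  HasColourIn B w = ∃ λ u → u ∈ B × c u ≡ c w

  hasColourIn? : ∀ B w → Dec (HasColourIn B w)
  hasColourIn? B w = any? (λ u → (u ∈? B) ×-dec (c u ≟ c w))

  module _ (D : TreeDecomposition G) where
    open TreeDecomposition D

    Gap : Set
    Gap = ∃ λ s → ∃ λ t → ∃ λ v → TreeAdj D s t × v ∈ bag s × ¬ HasColourIn (bag t) v

    gap? : Dec Gap
    gap? = any? λ s → any? λ t → any? λ v →
      (Graph.adj (Tree.graph tree) s t Bool.≟ true) ×-dec (v ∈? bag s) ×-dec ¬? (hasColourIn? (bag t) v)

    NoGap : Set
    NoGap = ∀ s t v → TreeAdj D s t → v ∈ bag s → HasColourIn (bag t) v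

    ¬Gap⇒NoGap : ¬ Gap → NoGap
    ¬Gap⇒NoGap ¬gap s t v st v∈s =
      decidable-stable (hasColourIn? (bag t) v) (λ ¬has → ¬gap (s , t , v , st , v∈s , ¬has))

    noGap⇒everyColour : NoGap → ∀ t w → HasColourIn (bag t) w
    noGap⇒everyColour noGap t w =
      walk-transport spread (Tree.connected tree t₀ t) (w , w∈t₀ , refl)
      where
      t₀ = proj₁ (covers w)
      w∈t₀ = proj₂ (covers w)
      spread : ∀ {s t} → TreeAdj D s t → HasColourIn (bag s) w → HasColourIn (bag t) w
      spread st (u , u∈s , cu≡cw) = let (u′ , u′∈t , cu′≡cu) = noGap _ _ u st u∈s in
        u′ , u′∈t , trans cu′≡cu cu≡cw

    addToBag-atMostOne : ∀ {s t v} (st : TreeAdj D s t) (v∈s : v ∈ bag s) →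
      AtMostOnePerColor c D → ¬ HasColourIn (bag t) v → AtMostOnePerColor c (addToBag D st v∈s)
    addToBag-atMostOne {t = t} {v} _ _ atMostOne ¬has t′ x y x∈t′ y∈t′ cx≡cy
      with ∈-insertAt⁻ bag t v x∈t′ | ∈-insertAt⁻ bag t v y∈t′
    ... | inj₁ x∈t′            | inj₁ y∈t′            = atMostOne t′ x y x∈t′ y∈t′ cx≡cy
    ... | inj₂ (refl , refl)   | inj₂ (_ , refl)      = refl
    ... | inj₂ (refl , refl)   | inj₁ y∈t             = ⊥-elim (¬has (y , y∈t , sym cx≡cy))
    ... | inj₁ x∈t             | inj₂ (refl , refl)   = ⊥-elim (¬has (x , x∈t , cx≡cy))

  saturate : ∀ fuel (D : TreeDecomposition G) → deficit (TreeDecomposition.bag D) < fuel →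
    AtMostOnePerColor c D → Σ (TreeDecomposition G) (ExactlyOnePerColor c)
  saturate (suc fuel) D deficit<fuel atMostOne with gap? D
  ... | no ¬gap = D , atMostOne , noGap⇒everyColour D (¬Gap⇒NoGap D ¬gap)
  ... | yes (s , t , v , st , v∈s , ¬has) =
    saturate fuel (addToBag D st v∈s) deficit′<fuel (addToBag-atMostOne D st v∈s atMostOne ¬has)
    where
    deficit′<fuel : deficit (insertAt (TreeDecomposition.bag D) t v) < fuel
    deficit′<fuel = <-≤-trans (deficit-insertAt _ t v (λ v∈t → ¬has (v , v∈t , refl))) (s≤s⁻¹ deficit<fuel)

lemma1 : (n k : ℕ) (G : Graph n) (c : Fin n → Fin k) →
    (Σ (TreeDecomposition G) (AtMostOnePerColor c))
    ⇔ (Σ (TreeDecomposition G) (ExactlyOnePerColor c))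
lemma1 n k G c = mk⇔
  (λ (D , atMostOne) → saturate c (suc (deficit (TreeDecomposition.bag D))) D (n<1+n _) atMostOne)
  (λ (D , atMostOne , _) → D , atMostOne)
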